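{- Let $m\ge 2$, $r,s\ge 1$ be integers. For each $i \in [m]$ and each distinct $j_1, j_2 \in [r]$, the set $S_{i,j_1} \cup S_{i,j_2}$ is a fort of $Py(m,r,s)$.
   Context: The peony graph $Py(m,r,s)$ has vertex set $\{c\} \cup \{u_i\}_{i=1}^m \cup \{v_{i,j,k} : i \in [m], j \in [r], k \in [s]\}$, where $[n]=\{1,\dots,n\}$ and indices $i$ are taken modulo $m$ (so $v_{0,j,k}=v_{m,j,k}$, $u_{m+1}=u_1$). Two distinct vertices $w,z$ are adjacent iff: $\{w,z\}=\{c,u_i\}$; $\{w,z\}=\{u_i,v_{i,j,1}\}$; $\{w,z\}=\{u_i,v_{i-1,j,s}\}$; or $\{w,z\}=\{v_{i,j,k},v_{i,j,k+1}\}$ with $k\in[s-1]$ (for some $i\in[m]$, $j\in[r]$). The layer $S_{i,j}$ is $\{v_{i,j,k}\}_{k=1}^s$. A set $S \subseteq V(G)$ is a fort of $G$ if every vertex $u \in V(G)\setminus S$ satisfies $|N_G(u)\cap S| \ne 1$, where $N_G(u)$ is the set of neighbors of $u$. -}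

module Defs where

open import Data.Nat using (ℕ; zero; suc; NonZero)
open import Data.Nat.DivMod using (_mod_)
open import Data.Fin using (Fin; toℕ)
open import Data.Product using (Σ; _×_; _,_)
open import Data.Sum using (_⊎_)
open import Data.Empty using (⊥)
open import Relation.Binary.PropositionalEquality using (_≡_)
open import Relation.Nullary using (¬_)

-- Vertices of the peony graph Py(m,r,s).  Indices are 0-based:
-- u i  stands for u_{i+1},  v i j k  stands for v_{i+1,j+1,k+1}.
data PyV (m r s : ℕ) : Set where
  c : PyV m r s
  u : Fin m → PyV m r s
  v : Fin m → Fin r → Fin s → PyV m r s

next : {m : ℕ} {{_ : NonZero m}} → Fin m → Fin m
next {m} i = suc (toℕ i) mod m

data Edge (m r s : ℕ) {{_ : NonZero m}} : PyV m r s → PyV m r s → Set where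
  e-cu : (i : Fin m) → Edge m r s c (u i)
  e-first : (i : Fin m) (j : Fin r) (k : Fin s) → toℕ k ≡ 0 →
            Edge m r s (u i) (v i j k)
  -- {u_{i+1}, v_{i,j,s}}  (equivalently {u_i, v_{i-1,j,s}}, indices mod m)
  e-last : (i : Fin m) (j : Fin r) (k : Fin s) → suc (toℕ k) ≡ s →
           Edge m r s (u (next i)) (v i j k)
  e-path : (i : Fin m) (j : Fin r) (k k' : Fin s) → toℕ k' ≡ suc (toℕ k) →
           Edge m r s (v i j k) (v i j k')

data Adj (m r s : ℕ) {{_ : NonZero m}} (w z : PyV m r s) : Set where
  fwd : ¬ (w ≡ z) → Edge m r s w z → Adj m r s w z
  bwd : ¬ (w ≡ z) → Edge m r s z w → Adj m r s w z

ExactlyOneNbrIn : (m r s : ℕ) {{_ : NonZero m}} → (PyV m r s → Set) → PyV m r s → Set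
ExactlyOneNbrIn m r s S x =
  Σ (PyV m r s) λ w → (Adj m r s x w × S w) ×
    ((z : PyV m r s) → Adj m r s x z → S z → z ≡ w)

IsFort : (m r s : ℕ) {{_ : NonZero m}} → (PyV m r s → Set) → Set
IsFort m r s S = (x : PyV m r s) → ¬ S x → ¬ ExactlyOneNbrIn m r s S x

TwoLayers : (m r s : ℕ) → Fin m → Fin r → Fin r → PyV m r s → Set
TwoLayers m r s i j₁ j₂ c = ⊥
TwoLayers m r s i j₁ j₂ (u _) = ⊥
TwoLayers m r s i j₁ j₂ (v i' j k) = i' ≡ i × (j ≡ j₁ ⊎ j ≡ j₂)

{-# OPTIONS --safe #-}
module Submission where

-- Only the hubs u_i can lie outside a union of whole layers and still see it,
-- since path edges stay inside a layer and c sees no layer vertex.  A hub adjacent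
-- to v_{i,j,k} is adjacent to v_{i,j',k} for every j', so as soon as each layer
-- met by S is accompanied by a second layer of S with the same i, every hub
-- sees either no vertex of S or at least two.

open import Defs
open import Data.Nat using (ℕ; _≤_; NonZero)
open import Data.Fin using (Fin)
open import Data.Product using (Σ; _×_; _,_)
open import Data.Sum using (inj₁; inj₂)
open import Data.Empty using (⊥)
open import Relation.Binary.PropositionalEquality using (_≡_; _≢_; refl; ≢-sym)
open import Relation.Nullary using (¬_)

module _ {m r s : ℕ} {{_ : NonZero m}} where

  private
    V = PyV m r s
    _~_ : V → V → Set
    _~_ = Adj m r s

  ¬c~v : ∀ {i j k} → ¬ (c ~ v i j k)
  ¬c~v (fwd _ ())
  ¬c~v (bwd _ ())

  v~v⇒sameLayer : ∀ {i i' j j' k k'} → v i j k ~ v i' j' k' → i ≡ i' × j ≡ j'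
  v~v⇒sameLayer (fwd _ (e-path _ _ _ _ _)) = refl , refl
  v~v⇒sameLayer (bwd _ (e-path _ _ _ _ _)) = refl , refl

  u~v⇒u~v-anyLayer : ∀ {x i j k} → u x ~ v i j k → (j' : Fin r) → u x ~ v i j' k
  u~v⇒u~v-anyLayer (fwd _ (e-first i _ k k≡0)) j' = fwd (λ ()) (e-first i j' k k≡0)
  u~v⇒u~v-anyLayer (fwd _ (e-last i _ k k≡s)) j' = fwd (λ ()) (e-last i j' k k≡s)

  v-injʲ : ∀ {i i' j j' k k'} → _≡_ {A = V} (v i j k) (v i' j' k') → j ≡ j'
  v-injʲ refl = refl

  record IsTwinnedLayerUnion (S : V → Set) : Set where
    field
      c∉ : ¬ S c
      u∉ : ∀ x → ¬ S (u x)
      layer-closed : ∀ {i j k k'} → S (v i j k) → S (v i j k')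
      twin : ∀ {i j k} → S (v i j k) → Σ (Fin r) λ j' → j' ≢ j × S (v i j' k)

  twinnedLayerUnion⇒fort : ∀ {S} → IsTwinnedLayerUnion S → IsFort m r s S
  twinnedLayerUnion⇒fort {S} isS x x∉S (w , (x~w , w∈S) , unique) = go x w x~w w∈S x∉S unique
    where
    open IsTwinnedLayerUnion isS
    go : ∀ x w → x ~ w → S w → ¬ S x → (∀ z → x ~ z → S z → z ≡ w) → ⊥
    go _ c _ c∈S _ _ = c∉ c∈S
    go _ (u y) _ u∈S _ _ = u∉ y u∈S
    go c (v i j k) c~v _ _ _ = ¬c~v c~v
    go (u y) (v i j k) y~v v∈S _ unique with twin v∈S
    ... | j' , j'≢j , v'∈S = j'≢j (v-injʲ (unique (v i j' k) (u~v⇒u~v-anyLayer y~v j') v'∈S))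
    go (v _ _ _) (v _ _ _) x~v v∈S x∉S _ with v~v⇒sameLayer x~v
    ... | refl , refl = x∉S (layer-closed v∈S)

twoLayers-isTwinnedLayerUnion : ∀ {m r s} {{_ : NonZero m}} {i : Fin m} {j₁ j₂ : Fin r} →
                                j₁ ≢ j₂ → IsTwinnedLayerUnion (TwoLayers m r s i j₁ j₂)
twoLayers-isTwinnedLayerUnion {j₁ = j₁} {j₂} j₁≢j₂ = record
  { c∉ = λ ()
  ; u∉ = λ _ ()
  ; layer-closed = λ x∈S → x∈S
  ; twin = λ where
      (i≡ , inj₁ refl) → j₂ , ≢-sym j₁≢j₂ , (i≡ , inj₂ refl)
      (i≡ , inj₂ refl) → j₁ , j₁≢j₂ , (i≡ , inj₁ refl)
  }

claim1 : (m r s : ℕ) → 2 ≤ m → 1 ≤ r → 1 ≤ s → {{_ : NonZero m}} →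
    (i : Fin m) (j₁ j₂ : Fin r) → ¬ (j₁ ≡ j₂) →
    IsFort m r s (TwoLayers m r s i j₁ j₂)
claim1 m r s _ _ _ i j₁ j₂ j₁≢j₂ = twinnedLayerUnion⇒fort (twoLayers-isTwinnedLayerUnion j₁≢j₂)
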